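{- Let $k\ge 5$ be an integer, let $i\in[k]$, let $\ell=\lceil k/2\rceil$, and let $\mathcal{F}$ be the family of all $\ell$-subsets of $[k]$. Then there exists an $\{i\}$-preserving and $\{i\}$-intersection shifting bijection $h:\mathcal{F}\to\mathcal{F}$.
   Context: $[k]=\{1,\ldots,k\}$ and for $F\subseteq[k]$, $\overline{F}=[k]\setminus F$. For a family $\mathcal{F}$ of subsets of $[k]$, $L\subseteq[k]$ and a function $h:\mathcal{F}\to\mathcal{F}$: $h$ is $L$-preserving if $D\cap L=h(D)\cap L$ for every $D\in\mathcal{F}$; $h$ is $L$-intersection shifting if for every $D,E\in\mathcal{F}$ with $\emptyset\ne D\cap\overline{E}\subseteq L$ it holds that $(h(D)\cap\overline{h(E)})\setminus L\ne\emptyset$. -}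

module Defs where

open import Data.Nat using (ℕ; ⌈_/2⌉)
open import Data.Fin.Subset using (Subset; _∩_; _─_; ∁; ∣_∣; Nonempty; _⊆_)
open import Data.Product using (Σ; proj₁; _×_)
open import Relation.Binary.PropositionalEquality using (_≡_)
open import Level using (0ℓ)

Member : ∀ {k} → (Subset k → Set) → Set
Member {k} P = Σ (Subset k) P

Uniform : (k ℓ : ℕ) → Subset k → Set
Uniform k ℓ D = ∣ D ∣ ≡ ℓ

Preserving : ∀ {k} {P : Subset k → Set} → Subset k → (Member P → Member P) → Set
Preserving {P = P} L h = ∀ (D : Member P) → proj₁ D ∩ L ≡ proj₁ (h D) ∩ L

IntersectionShifting : ∀ {k} {P : Subset k → Set} → Subset k → (Member P → Member P) → Set
IntersectionShifting {P = P} L h =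
  ∀ (D E : Member P) →
    Nonempty (proj₁ D ∩ ∁ (proj₁ E)) →
    (proj₁ D ∩ ∁ (proj₁ E)) ⊆ L →
    Nonempty ((proj₁ (h D) ∩ ∁ (proj₁ (h E))) ─ L)

-- Sets avoiding i are fixed. A set D ∋ i keeps i, and D ∖ {i} is rotated inside the cycle
-- [k] ∖ {i}: by one step if it consists of at least two cyclic blocks, by two steps otherwise.
-- The number of blocks is rotation invariant, so this is a bijection preserving sizes and
-- membership of i. If ∅ ≠ D ∩ ∁E ⊆ {i}, then i ∈ D ∖ E and E ∖ {i} is D ∖ {i} plus one
-- point. Since D ∖ {i} has at least two elements and two non-elements, its rotation leaves
-- it in at least two points, and at most one of them lies in E.

module Submission where

open import Defs
open import Data.Nat using (ℕ; _≤_; ⌈_/2⌉)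
open import Data.Fin using (Fin; zero; suc)
open import Data.Fin.Subset using (⁅_⁆)
open import Data.Product using (Σ; _×_)
open import Function.Bundles using (_⤖_; module Bijection)

open import Level using (Level)
open import Data.Bool using (Bool; true; false; not; _∧_; if_then_else_)
open import Data.Nat using (zero; suc; _+_; _<_; z≤n; s≤s; _≤ᵇ_; _≤′_; ≤′-refl; ≤′-step)
open import Data.Nat.Properties
open import Data.Vec
  using (Vec; []; _∷_; _∷ʳ_; map; zipWith; init; last; initLast; lookup; insertAt; removeAt)
open import Data.Vec.Properties using (init-∷ʳ; last-∷ʳ; map-∷ʳ; map-insertAt; []=⇒lookup; lookup⇒[]=;
         insertAt-lookup; removeAt-insertAt; insertAt-removeAt)
open import Data.Fin.Subset using (Subset; _∩_; ∁; ∣_∣; _─_; _∈_; _⊆_; Nonempty)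
open import Data.Product using (proj₁; proj₂; _,_; ∃; ∃-syntax)
open import Data.Sum using (_⊎_; inj₁; inj₂)
open import Data.Bool.Properties using (not-injective; ¬-not; ∧-zeroʳ)
open import Relation.Nullary using (¬_; contradiction; ofʸ; ofⁿ; yes; no)
open import Function.Base using (id; _∘_)
open import Function.Bundles using (mk↔ₛ′)
open import Function.Properties.Inverse using (↔⇒⤖)
open import Data.Fin.Subset.Properties
  using (∣p∣≤n; p─⊥≡p; nonempty?; Empty-unique; ∣⊥∣≡0; ∩-zeroʳ; x∈p∩q⁻; x∈∁p⇒x∉p;
         x∈⁅y⁆⇒x≡y; p⊆q⇒∣p∣≤∣q∣; ∣⁅x⁆∣≡1; ∣∁p∣≡n∸∣p∣)
open import Relation.Binary.PropositionalEquality
open ≡-Reasoning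

private
  variable
    a : Level
    A B C : Set a
    m n : ℕ

rotateˡ : Vec A n → Vec A n
rotateˡ []       = []
rotateˡ (x ∷ xs) = xs ∷ʳ x

rotateʳ : Vec A n → Vec A n
rotateʳ {n = zero}  []       = []
rotateʳ {n = suc n} xs = last xs ∷ init xs

rotateˡ-rotateʳ : (xs : Vec A n) → rotateˡ (rotateʳ xs) ≡ xs
rotateˡ-rotateʳ []       = refl
rotateˡ-rotateʳ (x ∷ xs) = sym (proj₂ (proj₂ (initLast (x ∷ xs))))

rotateʳ-rotateˡ : (xs : Vec A n) → rotateʳ (rotateˡ xs) ≡ xs
rotateʳ-rotateˡ []       = refl
rotateʳ-rotateˡ (x ∷ xs) = cong₂ _∷_ (last-∷ʳ x xs) (init-∷ʳ x xs)

zipWith-∷ʳ : (f : A → B → C) (xs : Vec A n) (ys : Vec B n) (x : A) (y : B) →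
             zipWith f (xs ∷ʳ x) (ys ∷ʳ y) ≡ zipWith f xs ys ∷ʳ f x y
zipWith-∷ʳ f []       []       x y = refl
zipWith-∷ʳ f (x′ ∷ xs) (y′ ∷ ys) x y = cong (f x′ y′ ∷_) (zipWith-∷ʳ f xs ys x y)

rotateˡ-map : (f : A → B) (xs : Vec A n) → rotateˡ (map f xs) ≡ map f (rotateˡ xs)
rotateˡ-map f []       = refl
rotateˡ-map f (x ∷ xs) = sym (map-∷ʳ f x xs)

rotateˡ-zipWith : (f : A → B → C) (xs : Vec A n) (ys : Vec B n) →
                  rotateˡ (zipWith f xs ys) ≡ zipWith f (rotateˡ xs) (rotateˡ ys)
rotateˡ-zipWith f []       []       = refl
rotateˡ-zipWith f (x ∷ xs) (y ∷ ys) = sym (zipWith-∷ʳ f xs ys x y)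

rotateˡ^ : ℕ → Vec A n → Vec A n
rotateˡ^ zero    xs = xs
rotateˡ^ (suc t) xs = rotateˡ^ t (rotateˡ xs)

rotateˡ^-invariant : (w : Vec A n → B) → (∀ xs → w (rotateˡ xs) ≡ w xs) →
                     ∀ t xs → w (rotateˡ^ t xs) ≡ w xs
rotateˡ^-invariant w w∘rotateˡ zero    xs = refl
rotateˡ^-invariant w w∘rotateˡ (suc t) xs =
  trans (rotateˡ^-invariant w w∘rotateˡ t (rotateˡ xs)) (w∘rotateˡ xs)

∣p∷ʳx∣≡∣x∷p∣ : (p : Subset n) (x : Bool) → ∣ p ∷ʳ x ∣ ≡ ∣ x ∷ p ∣
∣p∷ʳx∣≡∣x∷p∣ []          x     = refl
∣p∷ʳx∣≡∣x∷p∣ (true ∷ p)  true  = cong suc (∣p∷ʳx∣≡∣x∷p∣ p true)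
∣p∷ʳx∣≡∣x∷p∣ (true ∷ p)  false = cong suc (∣p∷ʳx∣≡∣x∷p∣ p false)
∣p∷ʳx∣≡∣x∷p∣ (false ∷ p) x     = ∣p∷ʳx∣≡∣x∷p∣ p x

∣rotateˡ∣ : (p : Subset n) → ∣ rotateˡ p ∣ ≡ ∣ p ∣
∣rotateˡ∣ []      = refl
∣rotateˡ∣ (x ∷ p) = ∣p∷ʳx∣≡∣x∷p∣ p x

rotateˡ-∩∁ : (p q : Subset n) → rotateˡ (p ∩ ∁ q) ≡ rotateˡ p ∩ ∁ (rotateˡ q)
rotateˡ-∩∁ p q = trans (rotateˡ-zipWith _∧_ p (∁ q)) (cong (rotateˡ p ∩_) (rotateˡ-map not q))

∣rotateˡ-∩∁∣ : (p q : Subset n) → ∣ rotateˡ p ∩ ∁ (rotateˡ q) ∣ ≡ ∣ p ∩ ∁ q ∣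
∣rotateˡ-∩∁∣ p q = trans (cong ∣_∣ (sym (rotateˡ-∩∁ p q))) (∣rotateˡ∣ (p ∩ ∁ q))

∣∁rotateˡ∣ : (p : Subset n) → ∣ ∁ (rotateˡ p) ∣ ≡ ∣ ∁ p ∣
∣∁rotateˡ∣ p = trans (cong ∣_∣ (sym (rotateˡ-map not p))) (∣rotateˡ∣ (∁ p))

module _ (c : A → Bool) where

  onceOrTwice : (A → A) → A → A
  onceOrTwice f x = if c x then f x else f (f x)

  onceOrTwice-inverse : {f g : A → A} → (∀ x → c (f x) ≡ c x) → (∀ x → g (f x) ≡ x) →
                        ∀ x → onceOrTwice g (onceOrTwice f x) ≡ x
  onceOrTwice-inverse {f} {g} c∘f g∘f x with c x in eq
  ... | true  rewrite c∘f x | eq = g∘f x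
  ... | false rewrite c∘f (f x) | c∘f x | eq = trans (cong g (g∘f (f x))) (g∘f x)

  onceOrTwice-invariant : (w : A → B) {f : A → A} → (∀ x → w (f x) ≡ w x) →
                          ∀ x → w (onceOrTwice f x) ≡ w x
  onceOrTwice-invariant w {f} w∘f x with c x
  ... | true  = w∘f x
  ... | false = trans (w∘f (f x)) (w∘f x)

-- The number of j with j ∉ p and j + 1 ∈ p (mod n): the number of cyclic runs of p, unless p is ⊤.
blocks : Subset n → ℕ
blocks p = ∣ rotateˡ p ∩ ∁ p ∣

blocks-rotateˡ : (p : Subset n) → blocks (rotateˡ p) ≡ blocks p
blocks-rotateˡ p = ∣rotateˡ-∩∁∣ (rotateˡ p) p

manyBlocks : Subset n → Bool
manyBlocks p = 2 ≤ᵇ blocks p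

rotateByBlocks : Subset n → Subset n
rotateByBlocks = onceOrTwice manyBlocks rotateˡ

rotateByBlocks⁻¹ : Subset n → Subset n
rotateByBlocks⁻¹ = onceOrTwice manyBlocks rotateʳ

manyBlocks-rotateˡ : (p : Subset n) → manyBlocks (rotateˡ p) ≡ manyBlocks p
manyBlocks-rotateˡ p = cong (2 ≤ᵇ_) (blocks-rotateˡ p)

manyBlocks-rotateʳ : (p : Subset n) → manyBlocks (rotateʳ p) ≡ manyBlocks p
manyBlocks-rotateʳ p = trans (sym (manyBlocks-rotateˡ (rotateʳ p))) (cong manyBlocks (rotateˡ-rotateʳ p))

rotateByBlocks⁻¹-rotateByBlocks : (p : Subset n) → rotateByBlocks⁻¹ (rotateByBlocks p) ≡ p
rotateByBlocks⁻¹-rotateByBlocks =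
  onceOrTwice-inverse manyBlocks {rotateˡ} {rotateʳ} manyBlocks-rotateˡ rotateʳ-rotateˡ

rotateByBlocks-rotateByBlocks⁻¹ : (p : Subset n) → rotateByBlocks (rotateByBlocks⁻¹ p) ≡ p
rotateByBlocks-rotateByBlocks⁻¹ =
  onceOrTwice-inverse manyBlocks {rotateʳ} {rotateˡ} manyBlocks-rotateʳ rotateˡ-rotateʳ

∣rotateByBlocks∣ : (p : Subset n) → ∣ rotateByBlocks p ∣ ≡ ∣ p ∣
∣rotateByBlocks∣ = onceOrTwice-invariant manyBlocks ∣_∣ ∣rotateˡ∣

-- Positions are natural numbers; beyond the end every position is outside.
at : Subset n → ℕ → Bool
at []      _       = false
at (x ∷ p) zero    = x
at (x ∷ p) (suc j) = at p j

at-∩∁ : (p q : Subset n) (j : ℕ) → at (p ∩ ∁ q) j ≡ at p j ∧ not (at q j)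
at-∩∁ []      []      j       = refl
at-∩∁ (x ∷ p) (y ∷ q) zero    = refl
at-∩∁ (x ∷ p) (y ∷ q) (suc j) = at-∩∁ p q j

at-∩∁≡true : (p q : Subset n) {j : ℕ} → at p j ≡ true → at q j ≡ false → at (p ∩ ∁ q) j ≡ true
at-∩∁≡true p q {j} pj qj = trans (at-∩∁ p q j) (cong₂ (λ x y → x ∧ not y) pj qj)

at-∁ : (p : Subset n) {j : ℕ} → j < n → at (∁ p) j ≡ not (at p j)
at-∁ (x ∷ p) {zero}  _         = refl
at-∁ (x ∷ p) {suc j} (s≤s j<n) = at-∁ p j<n

at-∷ʳ : (p : Subset n) (x : Bool) {j : ℕ} → j < n → at (p ∷ʳ x) j ≡ at p j
at-∷ʳ (y ∷ p) x {zero}  _         = refl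
at-∷ʳ (y ∷ p) x {suc j} (s≤s j<n) = at-∷ʳ p x j<n

at-∷ʳ-last : (p : Subset n) (x : Bool) → at (p ∷ʳ x) n ≡ x
at-∷ʳ-last []      x = refl
at-∷ʳ-last (y ∷ p) x = at-∷ʳ-last p x

at-rotateˡ : (p : Subset n) {j : ℕ} → suc j < n → at (rotateˡ p) j ≡ at p (suc j)
at-rotateˡ (x ∷ p) (s≤s j<n) = at-∷ʳ p x j<n

at-rotateˡ-last : (p : Subset (suc n)) → at (rotateˡ p) n ≡ at p 0
at-rotateˡ-last (x ∷ p) = at-∷ʳ-last p x

at≡true⇒1≤∣p∣ : (p : Subset n) (j : ℕ) → at p j ≡ true → 1 ≤ ∣ p ∣
at≡true⇒1≤∣p∣ (true  ∷ p) j       _  = s≤s z≤n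
at≡true⇒1≤∣p∣ (false ∷ p) (suc j) pj = at≡true⇒1≤∣p∣ p j pj

at≡true⇒2≤∣p∣ : (p : Subset n) {i j : ℕ} → i < j → at p i ≡ true → at p j ≡ true → 2 ≤ ∣ p ∣
at≡true⇒2≤∣p∣ (true  ∷ p) {zero}  {suc j} _         _  pj = s≤s (at≡true⇒1≤∣p∣ p j pj)
at≡true⇒2≤∣p∣ (true  ∷ p) {suc i} {suc j} (s≤s i<j) pi pj = m≤n⇒m≤1+n (at≡true⇒2≤∣p∣ p i<j pi pj)
at≡true⇒2≤∣p∣ (false ∷ p) {suc i} {suc j} (s≤s i<j) pi pj = at≡true⇒2≤∣p∣ p i<j pi pj

1≤∣p∣⇒at≡true : (p : Subset n) → 1 ≤ ∣ p ∣ → ∃[ j ] j < n × at p j ≡ true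
1≤∣p∣⇒at≡true (true  ∷ p) _    = 0 , s≤s z≤n , refl
1≤∣p∣⇒at≡true (false ∷ p) 1≤∣p∣ with 1≤∣p∣⇒at≡true p 1≤∣p∣
... | j , j<n , pj = suc j , s≤s j<n , pj

2≤∣p∣⇒at≡true : (p : Subset n) → 2 ≤ ∣ p ∣ →
                ∃[ i ] ∃[ j ] i < j × j < n × at p i ≡ true × at p j ≡ true
2≤∣p∣⇒at≡true (true ∷ p) (s≤s 1≤∣p∣) with 1≤∣p∣⇒at≡true p 1≤∣p∣
... | j , j<n , pj = 0 , suc j , s≤s z≤n , s≤s j<n , refl , pj
2≤∣p∣⇒at≡true (false ∷ p) 2≤∣p∣ with 2≤∣p∣⇒at≡true p 2≤∣p∣
... | i , j , i<j , j<n , pi , pj = suc i , suc j , s≤s i<j , s≤s j<n , pi , pj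

at-∁≡true : (p : Subset n) {j : ℕ} → j < n → at (∁ p) j ≡ true → at p j ≡ false
at-∁≡true p j<n ∁pj = not-injective {y = false} (trans (sym (at-∁ p j<n)) ∁pj)

Rise : Subset n → ℕ → Set
Rise {n} p j = suc j < n × at p j ≡ false × at p (suc j) ≡ true

outsideUntilRise : (p : Subset n) {i j : ℕ} → i ≤′ j → j < n → at p i ≡ false →
                   at p j ≡ false ⊎ ∃ (Rise p)
outsideUntilRise p ≤′-refl _ pi = inj₁ pi
outsideUntilRise p {j = suc j} (≤′-step i≤′j) sj<n pi
  with outsideUntilRise p i≤′j (≤-trans (n≤1+n (suc j)) sj<n) pi
... | inj₂ rise = inj₂ rise
... | inj₁ pj with at p (suc j) in psj
...   | false = inj₁ refl
...   | true  = inj₂ (j , sj<n , pj , psj)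

Aligned : Subset (suc n) → Set
Aligned {n} p = at p 0 ≡ true × at p n ≡ false

rise⇒aligned : (p : Subset (suc n)) {j : ℕ} → Rise p j → Aligned (rotateˡ^ (suc j) p)
rise⇒aligned p {zero} (1<n , p0 , p1) =
  trans (at-rotateˡ p 1<n) p1 , trans (at-rotateˡ-last p) p0
rise⇒aligned {n} p {suc j} (ssj<n , psj , pssj) =
  rise⇒aligned (rotateˡ p) (sj<n , trans (at-rotateˡ p sj<n) psj , trans (at-rotateˡ p ssj<n) pssj)
  where
  sj<n : suc j < suc n
  sj<n = ≤-trans (n≤1+n _) ssj<n

align : (p : Subset (suc n)) → 1 ≤ ∣ p ∣ → 1 ≤ ∣ ∁ p ∣ → ∃[ t ] Aligned (rotateˡ^ t p)
align {n} p 1≤∣p∣ 1≤∣∁p∣ with at p 0 in p0 | at p n in pn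
... | true  | false = 0 , p0 , pn
... | false | _ with 1≤∣p∣⇒at≡true p 1≤∣p∣
...   | j , j<n , pj with outsideUntilRise p (≤⇒≤′ z≤n) j<n p0
...     | inj₁ pj′        = contradiction (trans (sym pj′) pj) λ ()
...     | inj₂ (i , rise) = suc i , rise⇒aligned p rise
align {n} p 1≤∣p∣ 1≤∣∁p∣ | true | true with 1≤∣p∣⇒at≡true (∁ p) 1≤∣∁p∣
...   | j , j<n , ∁pj with outsideUntilRise p (≤⇒≤′ (≤-pred j<n)) ≤-refl (at-∁≡true p j<n ∁pj)
...     | inj₁ pn′        = contradiction (trans (sym pn′) pn) λ ()
...     | inj₂ (i , rise) = suc i , rise⇒aligned p rise

-- An aligned set has a rise wrapping around at n; any other rise would give a second block.
aligned-noRise : (u : Subset (suc n)) → Aligned u → blocks u ≤ 1 → ∀ j → ¬ Rise u j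
aligned-noRise {n} u (u0 , un) blocks≤1 j (sj<n , uj , usj) =
  contradiction (≤-trans 2≤blocks blocks≤1) λ { (s≤s ()) }
  where
  2≤blocks : 2 ≤ blocks u
  2≤blocks = at≡true⇒2≤∣p∣ (rotateˡ u ∩ ∁ u) (≤-pred sj<n)
    (at-∩∁≡true (rotateˡ u) u (trans (at-rotateˡ u sj<n) usj) uj)
    (at-∩∁≡true (rotateˡ u) u (trans (at-rotateˡ-last u) u0) un)

noRise⇒at1 : (u : Subset n) → (∀ j → ¬ Rise u j) → 2 ≤ ∣ u ∣ → at u 1 ≡ true
noRise⇒at1 u noRise 2≤∣u∣ with at u 1 in u1 | 2≤∣p∣⇒at≡true u 2≤∣u∣
... | true  | _ = refl
... | false | i , j , i<j , j<n , _ , uj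
  with outsideUntilRise u (≤⇒≤′ (≤-trans (s≤s z≤n) i<j)) j<n u1
...   | inj₁ uj′        = contradiction (trans (sym uj′) uj) λ ()
...   | inj₂ (r , rise) = contradiction rise (noRise r)

noRise⇒at-penultimate : (u : Subset (suc (suc n))) → (∀ j → ¬ Rise u j) → 2 ≤ ∣ ∁ u ∣ → at u n ≡ false
noRise⇒at-penultimate {n} u noRise 2≤∣∁u∣ with 2≤∣p∣⇒at≡true (∁ u) 2≤∣∁u∣
... | i , j , i<j , j<ssn , ∁ui , _
  with outsideUntilRise u (≤⇒≤′ (≤-pred (≤-trans i<j (≤-pred j<ssn)))) (m<n⇒m<1+n (n<1+n n))
         (at-∁≡true u (<-trans i<j j<ssn) ∁ui)
...   | inj₁ un         = un
...   | inj₂ (r , rise) = contradiction rise (noRise r)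

-- An aligned single block looks like 1 1 ⋯ 0 0, so rotating twice moves its two leading
-- elements onto the two final non-elements.
aligned-singleBlock : (u : Subset (suc (suc n))) → Aligned u → 2 ≤ ∣ u ∣ → 2 ≤ ∣ ∁ u ∣ → blocks u ≤ 1 →
                      2 ≤ ∣ rotateˡ (rotateˡ u) ∩ ∁ u ∣
aligned-singleBlock {n} u aligned@(u0 , un) 2≤∣u∣ 2≤∣∁u∣ blocks≤1 =
  at≡true⇒2≤∣p∣ (rotateˡ (rotateˡ u) ∩ ∁ u) (n<1+n n)
    (at-∩∁≡true (rotateˡ (rotateˡ u)) u
      (trans (at-rotateˡ (rotateˡ u) ≤-refl) (trans (at-rotateˡ-last u) u0))
      (noRise⇒at-penultimate u noRise 2≤∣∁u∣))
    (at-∩∁≡true (rotateˡ (rotateˡ u)) u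
      (trans (at-rotateˡ-last (rotateˡ u))
             (trans (at-rotateˡ u (s≤s (s≤s z≤n))) (noRise⇒at1 u noRise 2≤∣u∣)))
      un)
  where
  noRise : ∀ j → ¬ Rise u j
  noRise = aligned-noRise u aligned blocks≤1

singleBlock : (p : Subset n) → 2 ≤ ∣ p ∣ → 2 ≤ ∣ ∁ p ∣ → blocks p ≤ 1 → 2 ≤ ∣ rotateˡ (rotateˡ p) ∩ ∁ p ∣
singleBlock {zero}        p 2≤∣p∣ _ _ = contradiction (≤-trans 2≤∣p∣ (∣p∣≤n p)) λ ()
singleBlock {suc zero}    p 2≤∣p∣ _ _ = contradiction (≤-trans 2≤∣p∣ (∣p∣≤n p)) λ { (s≤s ()) }
singleBlock {suc (suc n)} p 2≤∣p∣ 2≤∣∁p∣ blocks≤1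
  with align p (≤-trans (n≤1+n 1) 2≤∣p∣) (≤-trans (n≤1+n 1) 2≤∣∁p∣)
... | t , aligned = subst (2 ≤_) (invariant moved₂ moved₂-rotateˡ)
  (aligned-singleBlock (rotateˡ^ t p) aligned
    (subst (2 ≤_) (sym (invariant ∣_∣ ∣rotateˡ∣)) 2≤∣p∣)
    (subst (2 ≤_) (sym (invariant (λ q → ∣ ∁ q ∣) ∣∁rotateˡ∣)) 2≤∣∁p∣)
    (subst (_≤ 1) (sym (invariant blocks blocks-rotateˡ)) blocks≤1))
  where
  invariant : (w : Subset (suc (suc n)) → ℕ) → (∀ q → w (rotateˡ q) ≡ w q) → w (rotateˡ^ t p) ≡ w p
  invariant w w∘rotateˡ = rotateˡ^-invariant w w∘rotateˡ t p
  moved₂ : Subset (suc (suc n)) → ℕ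
  moved₂ q = ∣ rotateˡ (rotateˡ q) ∩ ∁ q ∣
  moved₂-rotateˡ : ∀ q → moved₂ (rotateˡ q) ≡ moved₂ q
  moved₂-rotateˡ q = ∣rotateˡ-∩∁∣ (rotateˡ (rotateˡ q)) q

rotateByBlocks-moves-two : (p : Subset n) → 2 ≤ ∣ p ∣ → 2 ≤ ∣ ∁ p ∣ → 2 ≤ ∣ rotateByBlocks p ∩ ∁ p ∣
rotateByBlocks-moves-two p 2≤∣p∣ 2≤∣∁p∣ with manyBlocks p | ≤ᵇ-reflects-≤ 2 (blocks p)
... | true  | ofʸ 2≤blocks = 2≤blocks
... | false | ofⁿ 2≰blocks = singleBlock p 2≤∣p∣ 2≤∣∁p∣ (≤-pred (≰⇒> 2≰blocks))

∣x∷p∣≡∣x∷q∣ : (x : Bool) (p : Subset m) (q : Subset n) → ∣ p ∣ ≡ ∣ q ∣ → ∣ x ∷ p ∣ ≡ ∣ x ∷ q ∣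
∣x∷p∣≡∣x∷q∣ true  _ _ = cong suc
∣x∷p∣≡∣x∷q∣ false _ _ = id

∣insertAt∣ : (p : Subset n) (i : Fin (suc n)) (x : Bool) → ∣ insertAt p i x ∣ ≡ ∣ x ∷ p ∣
∣insertAt∣ p           zero    x     = refl
∣insertAt∣ (true  ∷ p) (suc i) true  = cong suc (∣insertAt∣ p i true)
∣insertAt∣ (true  ∷ p) (suc i) false = cong suc (∣insertAt∣ p i false)
∣insertAt∣ (false ∷ p) (suc i) x     = ∣insertAt∣ p i x

∣insertAt─⁅i⁆∣ : (p : Subset n) (i : Fin (suc n)) (x : Bool) → ∣ insertAt p i x ─ ⁅ i ⁆ ∣ ≡ ∣ p ∣
∣insertAt─⁅i⁆∣ p       zero    x = cong ∣_∣ (p─⊥≡p p)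
∣insertAt─⁅i⁆∣ (y ∷ p) (suc i) x = ∣x∷p∣≡∣x∷q∣ y (insertAt p i x ─ ⁅ i ⁆) p (∣insertAt─⁅i⁆∣ p i x)

zipWith-insertAt : (f : A → B → C) (xs : Vec A n) (ys : Vec B n) (i : Fin (suc n)) (x : A) (y : B) →
                   zipWith f (insertAt xs i x) (insertAt ys i y) ≡ insertAt (zipWith f xs ys) i (f x y)
zipWith-insertAt f xs        ys        zero    x y = refl
zipWith-insertAt f (x′ ∷ xs) (y′ ∷ ys) (suc i) x y = cong (f x′ y′ ∷_) (zipWith-insertAt f xs ys i x y)

insertAt-∩∁ : (p q : Subset n) (i : Fin (suc n)) (x y : Bool) →
              insertAt p i x ∩ ∁ (insertAt q i y) ≡ insertAt (p ∩ ∁ q) i (x ∧ not y)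
insertAt-∩∁ p q i x y =
  trans (cong (insertAt p i x ∩_) (map-insertAt not y q i)) (zipWith-insertAt _∧_ p (∁ q) i x (not y))

∣p∩∁q∣+∣q∣≡∣q∩∁p∣+∣p∣ : (p q : Subset n) → ∣ p ∩ ∁ q ∣ + ∣ q ∣ ≡ ∣ q ∩ ∁ p ∣ + ∣ p ∣
∣p∩∁q∣+∣q∣≡∣q∩∁p∣+∣p∣ []          []          = refl
∣p∩∁q∣+∣q∣≡∣q∩∁p∣+∣p∣ (true  ∷ p) (true  ∷ q) =
  trans (+-suc _ _) (trans (cong suc (∣p∩∁q∣+∣q∣≡∣q∩∁p∣+∣p∣ p q)) (sym (+-suc _ _)))
∣p∩∁q∣+∣q∣≡∣q∩∁p∣+∣p∣ (true  ∷ p) (false ∷ q) =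
  trans (cong suc (∣p∩∁q∣+∣q∣≡∣q∩∁p∣+∣p∣ p q)) (sym (+-suc _ _))
∣p∩∁q∣+∣q∣≡∣q∩∁p∣+∣p∣ (false ∷ p) (true  ∷ q) = trans (+-suc _ _) (cong suc (∣p∩∁q∣+∣q∣≡∣q∩∁p∣+∣p∣ p q))
∣p∩∁q∣+∣q∣≡∣q∩∁p∣+∣p∣ (false ∷ p) (false ∷ q) = ∣p∩∁q∣+∣q∣≡∣q∩∁p∣+∣p∣ p q

∣q∩∁p∣≡∣p∩∁q∣ : (p q : Subset n) → ∣ p ∣ ≡ ∣ q ∣ → ∣ q ∩ ∁ p ∣ ≡ ∣ p ∩ ∁ q ∣
∣q∩∁p∣≡∣p∩∁q∣ p q ∣p∣≡∣q∣ = sym (+-cancelʳ-≡ (∣ q ∣) (∣ p ∩ ∁ q ∣) (∣ q ∩ ∁ p ∣)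
  (trans (∣p∩∁q∣+∣q∣≡∣q∩∁p∣+∣p∣ p q) (cong (∣ q ∩ ∁ p ∣ +_) ∣p∣≡∣q∣)))

∣p∩∁r∣≤∣p∩∁q∣+∣q∩∁r∣ : (p q r : Subset n) → ∣ p ∩ ∁ r ∣ ≤ ∣ p ∩ ∁ q ∣ + ∣ q ∩ ∁ r ∣
∣p∩∁r∣≤∣p∩∁q∣+∣q∩∁r∣ []          []          []          = z≤n
∣p∩∁r∣≤∣p∩∁q∣+∣q∩∁r∣ (true  ∷ p) (true  ∷ q) (true  ∷ r) = ∣p∩∁r∣≤∣p∩∁q∣+∣q∩∁r∣ p q r
∣p∩∁r∣≤∣p∩∁q∣+∣q∩∁r∣ (true  ∷ p) (true  ∷ q) (false ∷ r) =
  ≤-trans (s≤s (∣p∩∁r∣≤∣p∩∁q∣+∣q∩∁r∣ p q r)) (≤-reflexive (sym (+-suc ∣ p ∩ ∁ q ∣ _)))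
∣p∩∁r∣≤∣p∩∁q∣+∣q∩∁r∣ (true  ∷ p) (false ∷ q) (true  ∷ r) = m≤n⇒m≤1+n (∣p∩∁r∣≤∣p∩∁q∣+∣q∩∁r∣ p q r)
∣p∩∁r∣≤∣p∩∁q∣+∣q∩∁r∣ (true  ∷ p) (false ∷ q) (false ∷ r) = s≤s (∣p∩∁r∣≤∣p∩∁q∣+∣q∩∁r∣ p q r)
∣p∩∁r∣≤∣p∩∁q∣+∣q∩∁r∣ (false ∷ p) (true  ∷ q) (true  ∷ r) = ∣p∩∁r∣≤∣p∩∁q∣+∣q∩∁r∣ p q r
∣p∩∁r∣≤∣p∩∁q∣+∣q∩∁r∣ (false ∷ p) (true  ∷ q) (false ∷ r) =
  ≤-trans (∣p∩∁r∣≤∣p∩∁q∣+∣q∩∁r∣ p q r) (+-monoʳ-≤ ∣ p ∩ ∁ q ∣ (n≤1+n _))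
∣p∩∁r∣≤∣p∩∁q∣+∣q∩∁r∣ (false ∷ p) (false ∷ q) (true  ∷ r) = ∣p∩∁r∣≤∣p∩∁q∣+∣q∩∁r∣ p q r
∣p∩∁r∣≤∣p∩∁q∣+∣q∩∁r∣ (false ∷ p) (false ∷ q) (false ∷ r) = ∣p∩∁r∣≤∣p∩∁q∣+∣q∩∁r∣ p q r

1≤∣p∣⇒Nonempty : (p : Subset n) → 1 ≤ ∣ p ∣ → Nonempty p
1≤∣p∣⇒Nonempty {n} p 1≤∣p∣ with nonempty? p
... | yes ne = ne
... | no ¬ne = contradiction (trans (cong ∣_∣ (Empty-unique ¬ne)) (∣⊥∣≡0 n)) (>⇒≢ 1≤∣p∣)

lookup≡⇒∩⁅i⁆≡ : (p q : Subset n) (i : Fin n) → lookup p i ≡ lookup q i → p ∩ ⁅ i ⁆ ≡ q ∩ ⁅ i ⁆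
lookup≡⇒∩⁅i⁆≡ (x ∷ p) (y ∷ q) zero    x≡y =
  cong₂ _∷_ (cong (_∧ true) x≡y) (trans (∩-zeroʳ p) (sym (∩-zeroʳ q)))
lookup≡⇒∩⁅i⁆≡ (x ∷ p) (y ∷ q) (suc i) pi≡qi =
  cong₂ _∷_ (trans (∧-zeroʳ x) (sym (∧-zeroʳ y))) (lookup≡⇒∩⁅i⁆≡ p q i pi≡qi)

∈p∩∁q⇒lookup : (p q : Subset n) {i : Fin n} → i ∈ p ∩ ∁ q → lookup p i ≡ true × lookup q i ≡ false
∈p∩∁q⇒lookup p q i∈ =
  []=⇒lookup (proj₁ (x∈p∩q⁻ p (∁ q) i∈)) ,
  ¬-not (x∈∁p⇒x∉p (proj₂ (x∈p∩q⁻ p (∁ q) i∈)) ∘ lookup⇒[]= _ q)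

extendAt : Fin (suc n) → (Subset n → Subset n) → Subset (suc n) → Subset (suc n)
extendAt i f p = insertAt (if lookup p i then f (removeAt p i) else removeAt p i) i (lookup p i)

module _ (i : Fin (suc n)) (f : Subset n → Subset n) where

  lookup-extendAt : (p : Subset (suc n)) → lookup (extendAt i f p) i ≡ lookup p i
  lookup-extendAt p = insertAt-lookup _ i (lookup p i)

  extendAt-inverse : (g : Subset n → Subset n) → (∀ q → g (f q) ≡ q) →
                     ∀ p → extendAt i g (extendAt i f p) ≡ p
  extendAt-inverse g g∘f p = begin
    extendAt i g (extendAt i f p)
      ≡⟨ cong₂ (λ x r → insertAt (if x then g r else r) i x)
               (lookup-extendAt p) (removeAt-insertAt _ i (lookup p i)) ⟩
    insertAt (if x then g (if x then f q else q) else (if x then f q else q)) i x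
      ≡⟨ cong (λ r → insertAt r i x) (undo x) ⟩
    insertAt q i x
      ≡⟨ insertAt-removeAt p i ⟩
    p ∎
    where
    x = lookup p i
    q = removeAt p i
    undo : ∀ y → (if y then g (if y then f q else q) else (if y then f q else q)) ≡ q
    undo true  = g∘f q
    undo false = refl

  ∣extendAt∣ : (∀ q → ∣ f q ∣ ≡ ∣ q ∣) → ∀ p → ∣ extendAt i f p ∣ ≡ ∣ p ∣
  ∣extendAt∣ ∣f∣ p = begin
    ∣ extendAt i f p ∣            ≡⟨ ∣insertAt∣ _ i x ⟩
    ∣ x ∷ (if x then f q else q) ∣ ≡⟨ ∣x∷p∣≡∣x∷q∣ x (if x then f q else q) q (resize x) ⟩
    ∣ x ∷ q ∣                     ≡⟨ ∣insertAt∣ q i x ⟨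
    ∣ insertAt q i x ∣            ≡⟨ cong ∣_∣ (insertAt-removeAt p i) ⟩
    ∣ p ∣ ∎
    where
    x = lookup p i
    q = removeAt p i
    resize : ∀ y → ∣ (if y then f q else q) ∣ ≡ ∣ q ∣
    resize true  = ∣f∣ q
    resize false = refl

  extendAt-shifting : (D E : Subset (suc n)) → ∣ D ∣ ≡ ∣ E ∣ → Nonempty (D ∩ ∁ E) → D ∩ ∁ E ⊆ ⁅ i ⁆ →
                      (∀ q → suc ∣ q ∣ ≡ ∣ D ∣ → 2 ≤ ∣ f q ∩ ∁ q ∣) →
                      Nonempty ((extendAt i f D ∩ ∁ (extendAt i f E)) ─ ⁅ i ⁆)
  extendAt-shifting D E ∣D∣≡∣E∣ (j , j∈) D∩∁E⊆⁅i⁆ f-moves-two =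
    subst (λ r → Nonempty (r ─ ⁅ i ⁆)) (sym image)
      (1≤∣p∣⇒Nonempty _ (subst (1 ≤_) (sym (∣insertAt─⁅i⁆∣ (f D′ ∩ ∁ E′) i true)) 1≤∣fD′∩∁E′∣))
    where
    D′ E′ : Subset n
    D′ = removeAt D i
    E′ = removeAt E i
    Di×Ei : lookup D i ≡ true × lookup E i ≡ false
    Di×Ei = ∈p∩∁q⇒lookup D E (subst (_∈ D ∩ ∁ E) (x∈⁅y⁆⇒x≡y i (D∩∁E⊆⁅i⁆ j∈)) j∈)
    D≡ : insertAt D′ i true ≡ D
    D≡ = trans (cong (insertAt D′ i) (sym (proj₁ Di×Ei))) (insertAt-removeAt D i)
    E≡ : insertAt E′ i false ≡ E
    E≡ = trans (cong (insertAt E′ i) (sym (proj₂ Di×Ei))) (insertAt-removeAt E i)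
    image : extendAt i f D ∩ ∁ (extendAt i f E) ≡ insertAt (f D′ ∩ ∁ E′) i true
    image = trans
      (cong₂ (λ x y → insertAt (if x then f D′ else D′) i x ∩ ∁ (insertAt (if y then f E′ else E′) i y))
             (proj₁ Di×Ei) (proj₂ Di×Ei))
      (insertAt-∩∁ (f D′) E′ i true false)
    1+∣D′∣≡∣D∣ : suc ∣ D′ ∣ ≡ ∣ D ∣
    1+∣D′∣≡∣D∣ = trans (sym (∣insertAt∣ D′ i true)) (cong ∣_∣ D≡)
    ∣E′∩∁D′∣≡∣E∩∁D∣ : ∣ E′ ∩ ∁ D′ ∣ ≡ ∣ E ∩ ∁ D ∣
    ∣E′∩∁D′∣≡∣E∩∁D∣ = begin
      ∣ E′ ∩ ∁ D′ ∣                                    ≡⟨ ∣insertAt∣ (E′ ∩ ∁ D′) i false ⟨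
      ∣ insertAt (E′ ∩ ∁ D′) i false ∣                 ≡⟨ cong ∣_∣ (insertAt-∩∁ E′ D′ i false true) ⟨
      ∣ insertAt E′ i false ∩ ∁ (insertAt D′ i true) ∣ ≡⟨ cong₂ (λ e d → ∣ e ∩ ∁ d ∣) E≡ D≡ ⟩
      ∣ E ∩ ∁ D ∣                                      ∎
    ∣E′∩∁D′∣≤1 : ∣ E′ ∩ ∁ D′ ∣ ≤ 1
    ∣E′∩∁D′∣≤1 = subst (_≤ 1) (sym (trans ∣E′∩∁D′∣≡∣E∩∁D∣ (∣q∩∁p∣≡∣p∩∁q∣ D E ∣D∣≡∣E∣)))
      (≤-trans (p⊆q⇒∣p∣≤∣q∣ D∩∁E⊆⁅i⁆) (≤-reflexive (∣⁅x⁆∣≡1 i)))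
    1≤∣fD′∩∁E′∣ : 1 ≤ ∣ f D′ ∩ ∁ E′ ∣
    1≤∣fD′∩∁E′∣ = +-cancelʳ-≤ 1 1 _ (≤-trans (f-moves-two D′ 1+∣D′∣≡∣D∣)
      (≤-trans (∣p∩∁r∣≤∣p∩∁q∣+∣q∩∁r∣ (f D′) E′ D′) (+-monoʳ-≤ (∣ f D′ ∩ ∁ E′ ∣) ∣E′∩∁D′∣≤1)))

module _ {k ℓ : ℕ} where

  member-≡ : {D E : Member (Uniform k ℓ)} → proj₁ D ≡ proj₁ E → D ≡ E
  member-≡ {_ , ∣D∣} {_ , ∣E∣} refl = cong (_ ,_) (≡-irrelevant ∣D∣ ∣E∣)

  restrict : (f : Subset k → Subset k) → (∀ p → ∣ f p ∣ ≡ ∣ p ∣) →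
             Member (Uniform k ℓ) → Member (Uniform k ℓ)
  restrict f ∣f∣ D = f (proj₁ D) , trans (∣f∣ (proj₁ D)) (proj₂ D)

  restrict-⤖ : (f g : Subset k → Subset k) → (∀ p → g (f p) ≡ p) → (∀ p → f (g p) ≡ p) →
               (∀ p → ∣ f p ∣ ≡ ∣ p ∣) → Member (Uniform k ℓ) ⤖ Member (Uniform k ℓ)
  restrict-⤖ f g g∘f f∘g ∣f∣ = ↔⇒⤖ (mk↔ₛ′ (restrict f ∣f∣) (restrict g ∣g∣)
    (λ D → member-≡ (f∘g (proj₁ D))) (λ D → member-≡ (g∘f (proj₁ D))))
    where
    ∣g∣ : ∀ p → ∣ g p ∣ ≡ ∣ p ∣
    ∣g∣ p = trans (sym (∣f∣ (g p))) (cong ∣_∣ (f∘g p))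

1+∣q∣≡⌈k/2⌉⇒2≤∣q∣∧2≤∣∁q∣ : (q : Subset m) → 5 ≤ suc m → suc ∣ q ∣ ≡ ⌈ suc m /2⌉ →
                           2 ≤ ∣ q ∣ × 2 ≤ ∣ ∁ q ∣
1+∣q∣≡⌈k/2⌉⇒2≤∣q∣∧2≤∣∁q∣ {m} q 5≤k 1+∣q∣≡ℓ =
  ≤-pred (subst (3 ≤_) (sym 1+∣q∣≡ℓ) (⌈n/2⌉-mono 5≤k)) ,
  subst (2 ≤_) (sym (∣∁p∣≡n∸∣p∣ q))
    (m+n≤o⇒m≤o∸n 2 (≤-pred (subst (λ x → 2 + x ≤ suc m) (sym 1+∣q∣≡ℓ) 2+ℓ≤k)))
  where
  2+ℓ≤k : 2 + ⌈ suc m /2⌉ ≤ suc m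
  2+ℓ≤k = subst (2 + ⌈ suc m /2⌉ ≤_) (⌊n/2⌋+⌈n/2⌉≡n (suc m)) (+-monoˡ-≤ ⌈ suc m /2⌉ (⌊n/2⌋-mono 5≤k))

lemma4 : (k : ℕ) → 5 ≤ k → (i : Fin k) →
    Σ (Member (Uniform k ⌈ k /2⌉) ⤖ Member (Uniform k ⌈ k /2⌉)) (λ h →
      Preserving ⁅ i ⁆ (Bijection.to h) × IntersectionShifting ⁅ i ⁆ (Bijection.to h))
lemma4 (suc m) 5≤k i = h , preserving , shifting
  where
  h : Member (Uniform (suc m) ⌈ suc m /2⌉) ⤖ Member (Uniform (suc m) ⌈ suc m /2⌉)
  h = restrict-⤖ (extendAt i rotateByBlocks) (extendAt i rotateByBlocks⁻¹)
        (extendAt-inverse i rotateByBlocks rotateByBlocks⁻¹ rotateByBlocks⁻¹-rotateByBlocks)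
        (extendAt-inverse i rotateByBlocks⁻¹ rotateByBlocks rotateByBlocks-rotateByBlocks⁻¹)
        (∣extendAt∣ i rotateByBlocks ∣rotateByBlocks∣)
  preserving : Preserving ⁅ i ⁆ (Bijection.to h)
  preserving (D , _) = lookup≡⇒∩⁅i⁆≡ D _ i (sym (lookup-extendAt i rotateByBlocks D))
  shifting : IntersectionShifting ⁅ i ⁆ (Bijection.to h)
  shifting (D , ∣D∣) (E , ∣E∣) D∩∁E≢∅ D∩∁E⊆⁅i⁆ =
    extendAt-shifting i rotateByBlocks D E (trans ∣D∣ (sym ∣E∣)) D∩∁E≢∅ D∩∁E⊆⁅i⁆
      λ q 1+∣q∣≡∣D∣ → let (2≤∣q∣ , 2≤∣∁q∣) = 1+∣q∣≡⌈k/2⌉⇒2≤∣q∣∧2≤∣∁q∣ q 5≤k (trans 1+∣q∣≡∣D∣ ∣D∣)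
                      in rotateByBlocks-moves-two q 2≤∣q∣ 2≤∣∁q∣
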